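{- Let $P\subseteq\mathbb{R}^2$ be a set of at most four points, no three of which are collinear, and let $q_1,q_2\in\mathbb{R}^2\setminus P$. Then the family $\mathcal{F}_2'=\{l_1\cup l_2 : l_1,l_2 \text{ lines in } \mathbb{R}^2,\ (l_1\cup l_2)\cap\{q_1,q_2\}=\emptyset\}$ shatters $P$.
   Context: A family $\mathcal{S}$ shatters $P$ if for every $Z\subseteq P$ there is $S\in\mathcal{S}$ with $S\cap P=Z$. -}

module Defs where

open import Level using (0ℓ)
open import Data.Nat using (ℕ)
open import Data.Fin using (Fin)
open import Data.Bool using (Bool; true)
open import Data.Product using (Σ; ∃; _×_; _,_)
open import Data.Sum using (_⊎_)
open import Relation.Nullary using (¬_)
open import Relation.Binary.PropositionalEquality using (_≡_)
open import Relation.Binary.Structures using (IsStrictTotalOrder)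
open import Algebra.Structures using (IsCommutativeRing)
open import Function.Bundles using (_⇔_)

-- Any structure satisfying these axioms is isomorphic to ℝ, so
-- quantifying over all such structures is a faithful rendering of ℝ.
record RealField : Set₁ where
  infixl 6 _+_
  infixl 7 _*_
  infix 4 _<_ _≤_
  field
    Carrier : Set
    _+_ _*_ : Carrier → Carrier → Carrier
    -_      : Carrier → Carrier
    0# 1#   : Carrier
    _<_     : Carrier → Carrier → Set
    isCommutativeRing : IsCommutativeRing _≡_ _+_ _*_ -_ 0# 1#
    0≢1     : ¬ (0# ≡ 1#)
    inverse : ∀ x → ¬ (x ≡ 0#) → ∃ λ y → x * y ≡ 1#
    isStrictTotalOrder : IsStrictTotalOrder _≡_ _<_
    +-mono-< : ∀ {x y} z → x < y → x + z < y + z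
    *-pos    : ∀ {x y} → 0# < x → 0# < y → 0# < x * y

  _≤_ : Carrier → Carrier → Set
  x ≤ y = x < y ⊎ x ≡ y

  field
    complete : (S : Carrier → Set) → (∃ λ x → S x) →
               (∃ λ b → ∀ x → S x → x ≤ b) →
               ∃ λ s → (∀ x → S x → x ≤ s) ×
                       (∀ b → (∀ x → S x → x ≤ b) → s ≤ b)

module Plane (ℝ : RealField) where
  open RealField ℝ

  Point : Set
  Point = Carrier × Carrier

  record Line : Set where
    constructor line
    field
      a b c   : Carrier
      nondeg  : ¬ (a ≡ 0# × b ≡ 0#)

  _∈L_ : Point → Line → Set
  (x , y) ∈L line a b c _ = a * x + b * y ≡ c

  _∈∪_ : Point → Line × Line → Set
  p ∈∪ (l₁ , l₂) = p ∈L l₁ ⊎ p ∈L l₂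

  Collinear : Point → Point → Point → Set
  Collinear p q r = ∃ λ (l : Line) → p ∈L l × q ∈L l × r ∈L l

  InF2' : Point → Point → Line × Line → Set
  InF2' q₁ q₂ L = ¬ (q₁ ∈∪ L) × ¬ (q₂ ∈∪ L)

  -- A finite point set P = {p i | i : Fin n}, given by distinct points.
  -- A family (predicate on Line × Line, read via _∈∪_) shatters P if every
  -- subset Z ⊆ P (as a characteristic function on indices) is cut out.
  Shatters : (Line × Line → Set) → {n : ℕ} → (Fin n → Point) → Set
  Shatters F {n} p =
    (Z : Fin n → Bool) →
    ∃ λ L → F L × (∀ i → (p i ∈∪ L) ⇔ (Z i ≡ true))

module Submission where

-- Through any point z there are infinitely many lines (slopes 0, 1, 2, …, the field having
-- characteristic 0), and every other point lies on at most one of them; so a line through z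
-- can avoid any finitely many other points, and likewise some vertical line avoids them all.
-- This cuts out every Z ⊆ P with |Z| ≤ 2 by one such line per point of Z. For |Z| = 3 or 4
-- some line must join two points of Z: since no three points of P are collinear, a point outside P lies
-- on at most one side of a triangle, and on sides of at most one of the three perfect
-- matchings of four points. Two points q₁, q₂ therefore leave a side (|Z| = 3) or a matching
-- (|Z| = 4) free, whose line(s) together with a line through the remaining point cut out Z.

open import Defs
open import Data.Nat using (ℕ; _≤_)
open import Data.Fin using (Fin)
open import Data.Product using (_×_)
open import Relation.Nullary using (¬_)
open import Relation.Binary.PropositionalEquality using (_≡_)

open import Algebra.Bundles using (CommutativeRing)
open import Algebra.Solver.Ring.AlmostCommutativeRing
  using (fromCommutativeRing; _-Raw-AlmostCommutative⟶_)
open import Data.Bool using (Bool; true)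
import Data.Bool as Bool
open import Data.Empty using (⊥; ⊥-elim)
import Data.Fin as Fin
open import Data.Integer as ℤ using (ℤ; -[1+_]; _⊖_)
import Data.Integer.Properties as ℤ
open import Data.List using (List; []; _∷_; tabulate; filter; allFin; length)
open import Data.List.Membership.Propositional using (_∈_)
open import Data.List.Membership.Propositional.Properties using (∈-filter⁺; ∈-allFin)
open import Data.List.Properties using (length-filter; length-tabulate)
open import Data.List.Relation.Unary.All as All using (All; []; _∷_)
open import Data.List.Relation.Unary.All.Properties using (tabulate⁻; all-filter)
open import Data.List.Relation.Unary.AllPairs using (AllPairs; []; _∷_)
open import Data.List.Relation.Unary.Unique.Propositional.Properties using (filter⁺; allFin⁺)
open import Data.Maybe using (Maybe)
import Data.Maybe as Maybe
open import Data.Nat as ℕ using (zero; suc; s≤s)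
import Data.Nat.Properties as ℕ
open import Data.Product using (Σ; ∃; _,_; proj₁; proj₂; map₂; curry)
open import Data.Product.Properties using (≡-dec)
import Data.Sign as Sign
open import Data.Sum using (_⊎_; inj₁; inj₂; [_,_])
import Data.Sum as Sum
open import Function using (_∘_)
open import Function.Bundles using (_⇔_; mk⇔; Equivalence)
open import Relation.Binary.Definitions using (tri<; tri≈; tri>)
open import Relation.Binary.PropositionalEquality
  using (refl; sym; trans; ≢-sym; cong; cong₂; subst; subst₂; module ≡-Reasoning)
open import Relation.Binary.Structures using (IsStrictTotalOrder)
open import Relation.Nullary using (Dec; yes; no)
open import Relation.Nullary.Decidable using (_×-dec_; _⊎-dec_; ¬?; dec⇒maybe)

module _ {B : Set} (Blocks : B → ℕ → Set) (Blocks? : ∀ b t → Dec (Blocks b t))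
         (Blocks-unique : ∀ b {s t} → Blocks b s → Blocks b t → s ≡ t) where

  unblocked-index-≥ : ∀ bs m → ∃ λ t → m ≤ t × All (λ b → ¬ Blocks b t) bs
  unblocked-index-≥ []       m = m , ℕ.≤-refl , []
  unblocked-index-≥ (b ∷ bs) m with unblocked-index-≥ bs m
  ... | t , m≤t , free with Blocks? b t
  ...   | no ¬blocks = t , m≤t , ¬blocks ∷ free
  ...   | yes blocks with unblocked-index-≥ bs (suc t)
  ...     | t′ , t<t′ , free′ =
    t′ , ℕ.≤-trans m≤t (ℕ.<⇒≤ t<t′) ,
    (λ blocks′ → ℕ.<-irrefl (Blocks-unique b blocks blocks′) t<t′) ∷ free′

  unblocked-index : ∀ bs → ∃ λ t → All (λ b → ¬ Blocks b t) bs
  unblocked-index bs = map₂ proj₂ (unblocked-index-≥ bs 0)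

one-of-three-avoids-both : {X : Set} (A₁ A₂ A₃ : X → Set) → (∀ x → Dec (A₁ x)) → (∀ x → Dec (A₂ x)) →
  (∀ x → A₁ x → ¬ A₂ x) → (∀ x → A₁ x → ¬ A₃ x) → (∀ x → A₂ x → ¬ A₃ x) → (x y : X) →
  (¬ A₁ x × ¬ A₁ y) ⊎ (¬ A₂ x × ¬ A₂ y) ⊎ (¬ A₃ x × ¬ A₃ y)
one-of-three-avoids-both A₁ A₂ A₃ A₁? A₂? A₁¬A₂ A₁¬A₃ A₂¬A₃ x y with A₁? x | A₁? y
... | no ¬a₁x | no ¬a₁y = inj₁ (¬a₁x , ¬a₁y)
... | yes a₁x | _ with A₂? y
...   | no ¬a₂y = inj₂ (inj₁ (A₁¬A₂ x a₁x , ¬a₂y))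
...   | yes a₂y = inj₂ (inj₂ (A₁¬A₃ x a₁x , A₂¬A₃ y a₂y))
one-of-three-avoids-both A₁ A₂ A₃ A₁? A₂? A₁¬A₂ A₁¬A₃ A₂¬A₃ x y | no ¬a₁x | yes a₁y with A₂? x
...   | no ¬a₂x = inj₂ (inj₁ (¬a₂x , A₁¬A₂ y a₁y))
...   | yes a₂x = inj₂ (inj₂ (A₂¬A₃ x a₂x , A₁¬A₃ y a₁y))

module Geometry (ℝ : RealField) where
  open RealField ℝ hiding (_≤_)
  open Plane ℝ

  commutativeRing : CommutativeRing _ _
  commutativeRing = record { isCommutativeRing = isCommutativeRing }

  open CommutativeRing commutativeRing
    using (_-_; +-comm; +-identityˡ; +-identityʳ; *-identityˡ; *-identityʳ; zeroʳ; -‿inverseʳ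
          ; ring; semiring; +-commutativeSemigroup)
  open import Algebra.Properties.Ring ring
    using (-0#≈0#; -‿involutive; -‿+-comm; -‿distribˡ-*; -‿distribʳ-*; +-cancelˡ
          ; x∙y⁻¹≈ε⇒x≈y; x≈y⇒x∙y⁻¹≈ε)
  open import Algebra.Properties.Semiring.Mult semiring renaming (_×_ to _×′_) using (×-homo-+; ×1-homo-*)
  open import Algebra.Properties.CommutativeSemigroup +-commutativeSemigroup using (interchange)
  open IsStrictTotalOrder isStrictTotalOrder using (_≟_; compare)
    renaming (trans to <-trans; irrefl to <-irrefl)
  open ≡-Reasoning

  module IntegerCoefficients where

    ⟦_⟧ : ℤ → Carrier
    ⟦ ℤ.+ n ⟧    = n ×′ 1#
    ⟦ -[1+ n ] ⟧ = - (suc n ×′ 1#)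

    -‿homo : ∀ i → ⟦ ℤ.- i ⟧ ≡ - ⟦ i ⟧
    -‿homo (ℤ.+ zero)  = sym -0#≈0#
    -‿homo (ℤ.+ suc n) = refl
    -‿homo -[1+ n ]    = sym (-‿involutive _)

    ⊖-homo : ∀ m n → ⟦ m ⊖ n ⟧ ≡ m ×′ 1# - n ×′ 1#
    ⊖-homo m       zero    = sym (trans (cong (λ x → m ×′ 1# + x) -0#≈0#) (+-identityʳ _))
    ⊖-homo zero    (suc n) = sym (+-identityˡ _)
    ⊖-homo (suc m) (suc n) = begin
      ⟦ suc m ⊖ suc n ⟧                   ≡⟨ cong ⟦_⟧ (ℤ.[1+m]⊖[1+n]≡m⊖n m n) ⟩
      ⟦ m ⊖ n ⟧                           ≡⟨ ⊖-homo m n ⟩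
      m ×′ 1# - n ×′ 1#                     ≡⟨ sym (+-identityˡ _) ⟩
      0# + (m ×′ 1# - n ×′ 1#)              ≡⟨ cong (_+ (m ×′ 1# - n ×′ 1#)) (sym (-‿inverseʳ 1#)) ⟩
      (1# - 1#) + (m ×′ 1# - n ×′ 1#)       ≡⟨ interchange _ _ _ _ ⟩
      (1# + m ×′ 1#) + (- 1# + - (n ×′ 1#)) ≡⟨ cong (λ x → (1# + m ×′ 1#) + x) (-‿+-comm _ _) ⟩
      (1# + m ×′ 1#) - (1# + n ×′ 1#)       ∎

    +-homo : ∀ i j → ⟦ i ℤ.+ j ⟧ ≡ ⟦ i ⟧ + ⟦ j ⟧
    +-homo (ℤ.+ m)  (ℤ.+ n)  = ×-homo-+ 1# m n
    +-homo (ℤ.+ m)  -[1+ n ] = ⊖-homo m (suc n)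
    +-homo -[1+ m ] (ℤ.+ n)  = trans (⊖-homo n (suc m)) (+-comm _ _)
    +-homo -[1+ m ] -[1+ n ] = begin
      - (suc (suc (m ℕ.+ n)) ×′ 1#)      ≡⟨ cong (λ k → - (suc k ×′ 1#)) (sym (ℕ.+-suc m n)) ⟩
      - ((suc m ℕ.+ suc n) ×′ 1#)        ≡⟨ cong -_ (×-homo-+ 1# (suc m) (suc n)) ⟩
      - (suc m ×′ 1# + suc n ×′ 1#)       ≡⟨ sym (-‿+-comm _ _) ⟩
      - (suc m ×′ 1#) + - (suc n ×′ 1#)   ∎

    *-homo : ∀ i j → ⟦ i ℤ.* j ⟧ ≡ ⟦ i ⟧ * ⟦ j ⟧
    *-homo (ℤ.+ m) (ℤ.+ n) = begin
      ⟦ Sign.+ ℤ.◃ (m ℕ.* n) ⟧           ≡⟨ cong ⟦_⟧ (ℤ.+◃n≡+n (m ℕ.* n)) ⟩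
      (m ℕ.* n) ×′ 1#                    ≡⟨ ×1-homo-* m n ⟩
      (m ×′ 1#) * (n ×′ 1#)               ∎
    *-homo (ℤ.+ m) -[1+ n ] = begin
      ⟦ Sign.- ℤ.◃ (m ℕ.* suc n) ⟧       ≡⟨ cong ⟦_⟧ (ℤ.-◃n≡-n (m ℕ.* suc n)) ⟩
      ⟦ ℤ.- ℤ.+ (m ℕ.* suc n) ⟧          ≡⟨ -‿homo (ℤ.+ (m ℕ.* suc n)) ⟩
      - ((m ℕ.* suc n) ×′ 1#)            ≡⟨ cong -_ (×1-homo-* m (suc n)) ⟩
      - ((m ×′ 1#) * (suc n ×′ 1#))       ≡⟨ -‿distribʳ-* _ _ ⟩
      (m ×′ 1#) * - (suc n ×′ 1#)         ∎
    *-homo -[1+ m ] (ℤ.+ n) = begin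
      ⟦ Sign.- ℤ.◃ (suc m ℕ.* n) ⟧       ≡⟨ cong ⟦_⟧ (ℤ.-◃n≡-n (suc m ℕ.* n)) ⟩
      ⟦ ℤ.- ℤ.+ (suc m ℕ.* n) ⟧          ≡⟨ -‿homo (ℤ.+ (suc m ℕ.* n)) ⟩
      - ((suc m ℕ.* n) ×′ 1#)            ≡⟨ cong -_ (×1-homo-* (suc m) n) ⟩
      - ((suc m ×′ 1#) * (n ×′ 1#))       ≡⟨ -‿distribˡ-* _ _ ⟩
      - (suc m ×′ 1#) * (n ×′ 1#)         ∎
    *-homo -[1+ m ] -[1+ n ] = begin
      (suc m ℕ.* suc n) ×′ 1#            ≡⟨ ×1-homo-* (suc m) (suc n) ⟩
      (suc m ×′ 1#) * (suc n ×′ 1#)       ≡⟨ cong (_* (suc n ×′ 1#)) (sym (-‿involutive _)) ⟩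
      - - (suc m ×′ 1#) * (suc n ×′ 1#)   ≡⟨ sym (-‿distribˡ-* _ _) ⟩
      - (- (suc m ×′ 1#) * (suc n ×′ 1#)) ≡⟨ -‿distribʳ-* _ _ ⟩
      - (suc m ×′ 1#) * - (suc n ×′ 1#)   ∎

    morphism : ℤ.+-*-rawRing -Raw-AlmostCommutative⟶ fromCommutativeRing commutativeRing
    morphism = record
      { ⟦_⟧ = ⟦_⟧ ; +-homo = +-homo ; *-homo = *-homo ; -‿homo = -‿homo
      ; 0-homo = refl ; 1-homo = +-identityʳ 1# }

    ⟦⟧-equal? : ∀ i j → Maybe (⟦ i ⟧ ≡ ⟦ j ⟧)
    ⟦⟧-equal? i j = Maybe.map (cong ⟦_⟧) (dec⇒maybe (i ℤ.≟ j))

  -- Coefficients in ℤ rather than in the field, so that the solver decides their equality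
  -- by evaluation and normal forms cancel.
  open import Algebra.Solver.Ring ℤ.+-*-rawRing (fromCommutativeRing commutativeRing)
    IntegerCoefficients.morphism IntegerCoefficients.⟦⟧-equal?
    using (solve; _:=_; _:+_; _:*_; _:-_; :-_; con)

  x*y≡0⇒y≡0 : ∀ {x y} → ¬ x ≡ 0# → x * y ≡ 0# → y ≡ 0#
  x*y≡0⇒y≡0 {x} {y} x≢0 xy≡0 with inverse x x≢0
  ... | x⁻¹ , xx⁻¹≡1 = begin
    y               ≡⟨ sym (*-identityˡ y) ⟩
    1# * y          ≡⟨ cong (_* y) (sym xx⁻¹≡1) ⟩
    (x * x⁻¹) * y   ≡⟨ solve 3 (λ x v y → (x :* v) :* y := v :* (x :* y)) refl x x⁻¹ y ⟩
    x⁻¹ * (x * y)   ≡⟨ cong (x⁻¹ *_) xy≡0 ⟩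
    x⁻¹ * 0#        ≡⟨ zeroʳ x⁻¹ ⟩
    0#              ∎

  0<1 : 0# < 1#
  0<1 with compare 0# 1#
  ... | tri< 0<1 _ _ = 0<1
  ... | tri≈ _ 0≡1 _ = ⊥-elim (0≢1 0≡1)
  ... | tri> _ _ 1<0 = ⊥-elim (<-irrefl refl (<-trans 1<0 0<[-1]²))
    where
    0<-1 : 0# < - 1#
    0<-1 = subst₂ _<_ (-‿inverseʳ 1#) (+-identityˡ (- 1#)) (+-mono-< (- 1#) 1<0)
    0<[-1]² : 0# < 1#
    0<[-1]² = subst (0# <_) (trans (solve 1 (λ x → (:- x) :* (:- x) := x :* x) refl 1#) (*-identityˡ 1#))
                   (*-pos 0<-1 0<-1)

  0<1+n : ∀ n → 0# < suc n ×′ 1#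
  0<1+n zero    = subst (0# <_) (sym (+-identityʳ 1#)) 0<1
  0<1+n (suc n) = <-trans 0<1 (subst₂ _<_ (+-identityˡ 1#) (+-comm _ 1#) (+-mono-< 1# (0<1+n n)))

  ×′1-injective : ∀ m n → m ×′ 1# ≡ n ×′ 1# → m ≡ n
  ×′1-injective zero    zero    _ = refl
  ×′1-injective zero    (suc n) e = ⊥-elim (<-irrefl e (0<1+n n))
  ×′1-injective (suc m) zero    e = ⊥-elim (<-irrefl (sym e) (0<1+n m))
  ×′1-injective (suc m) (suc n) e = cong suc (×′1-injective m n (+-cancelˡ 1# _ _ e))

  _≟ₚ_ : (a b : Point) → Dec (a ≡ b)
  _≟ₚ_ = ≡-dec _≟_ _≟_

  _∈L?_ : ∀ w L → Dec (w ∈L L)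
  (wx , wy) ∈L? line a b c _ = a * wx + b * wy ≟ c

  cross : Point → Point → Point → Carrier
  cross (ax , ay) (bx , by) (rx , ry) = (bx - ax) * (ry - ay) - (by - ay) * (rx - ax)

  cross-swap : ∀ a b r → cross b a r ≡ - cross a b r
  cross-swap (ax , ay) (bx , by) (rx , ry) = solve 6 (λ ax ay bx by rx ry →
    (ax :- bx) :* (ry :- by) :- (ay :- by) :* (rx :- bx) :=
    :- ((bx :- ax) :* (ry :- ay) :- (by :- ay) :* (rx :- ax))) refl ax ay bx by rx ry

  cross≡0-swap : ∀ {a b r} → cross a b r ≡ 0# → cross b a r ≡ 0#
  cross≡0-swap {a} {b} {r} e = trans (cross-swap a b r) (trans (cong -_ e) -0#≈0#)

  cross-left : ∀ a b → cross a b a ≡ 0#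
  cross-left (ax , ay) (bx , by) = solve 4 (λ ax ay bx by →
    (bx :- ax) :* (ay :- ay) :- (by :- ay) :* (ax :- ax) := con (ℤ.+ 0)) refl ax ay bx by

  cross-right : ∀ a b → cross a b b ≡ 0#
  cross-right (ax , ay) (bx , by) = solve 4 (λ ax ay bx by →
    (bx :- ax) :* (by :- ay) :- (by :- ay) :* (bx :- ax) := con (ℤ.+ 0)) refl ax ay bx by

  lineThrough : (a b : Point) → ¬ a ≡ b → Line
  lineThrough (ax , ay) (bx , by) a≢b =
    line (ay - by) (bx - ax) ((bx - ax) * ay - (by - ay) * ax) nondegenerate
    where
    nondegenerate : ¬ (ay - by ≡ 0# × bx - ax ≡ 0#)
    nondegenerate (ay-by≡0 , bx-ax≡0) =
      a≢b (cong₂ _,_ (sym (x∙y⁻¹≈ε⇒x≈y _ _ bx-ax≡0)) (x∙y⁻¹≈ε⇒x≈y _ _ ay-by≡0))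

  ∈-lineThrough⇔ : ∀ a b (a≢b : ¬ a ≡ b) r → r ∈L lineThrough a b a≢b ⇔ cross a b r ≡ 0#
  ∈-lineThrough⇔ (ax , ay) (bx , by) a≢b (rx , ry) =
    mk⇔ (λ r∈l → trans (sym equation) (x≈y⇒x∙y⁻¹≈ε r∈l))
        (λ cross≡0 → x∙y⁻¹≈ε⇒x≈y _ _ (trans equation cross≡0))
    where
    equation : (ay - by) * rx + (bx - ax) * ry - ((bx - ax) * ay - (by - ay) * ax)
             ≡ cross (ax , ay) (bx , by) (rx , ry)
    equation = solve 6 (λ ax ay bx by rx ry →
      (ay :- by) :* rx :+ (bx :- ax) :* ry :- ((bx :- ax) :* ay :- (by :- ay) :* ax) :=
      (bx :- ax) :* (ry :- ay) :- (by :- ay) :* (rx :- ax)) refl ax ay bx by rx ry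

  cross≡0⇒collinear : ∀ a b r → ¬ a ≡ b → cross a b r ≡ 0# → Collinear a b r
  cross≡0⇒collinear a b r a≢b cross≡0 =
    lineThrough a b a≢b , on (cross-left a b) , on (cross-right a b) , on cross≡0
    where
    on : ∀ {r} → cross a b r ≡ 0# → r ∈L lineThrough a b a≢b
    on = Equivalence.from (∈-lineThrough⇔ a b a≢b _)

  -- Cramer's rule: when both crosses through q vanish, cross a b c · (q − a) = 0.
  ≡-at-intersection : ∀ a b c q → ¬ cross a b c ≡ 0# → cross a b q ≡ 0# → cross a c q ≡ 0# → q ≡ a
  ≡-at-intersection (ax , ay) (bx , by) (cx , cy) (qx , qy) abc≢0 abq≡0 acq≡0 =
    cong₂ _,_ (x∙y⁻¹≈ε⇒x≈y _ _ (x*y≡0⇒y≡0 abc≢0 (trans cramerₓ (vanishes _ _ abq≡0 acq≡0))))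
              (x∙y⁻¹≈ε⇒x≈y _ _ (x*y≡0⇒y≡0 abc≢0 (trans cramerᵧ (vanishes _ _ abq≡0 acq≡0))))
    where
    a : Point
    a = (ax , ay)
    vanishes : ∀ {u v} s t → u ≡ 0# → v ≡ 0# → u * s - v * t ≡ 0#
    vanishes s t refl refl =
      solve 2 (λ s t → con (ℤ.+ 0) :* s :- con (ℤ.+ 0) :* t := con (ℤ.+ 0)) refl s t
    cramerₓ : cross a (bx , by) (cx , cy) * (qx - ax)
            ≡ cross a (bx , by) (qx , qy) * (cx - ax) - cross a (cx , cy) (qx , qy) * (bx - ax)
    cramerₓ = solve 8 (λ ax ay bx by cx cy qx qy →
      ((bx :- ax) :* (cy :- ay) :- (by :- ay) :* (cx :- ax)) :* (qx :- ax) :=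
      ((bx :- ax) :* (qy :- ay) :- (by :- ay) :* (qx :- ax)) :* (cx :- ax) :-
      ((cx :- ax) :* (qy :- ay) :- (cy :- ay) :* (qx :- ax)) :* (bx :- ax)) refl ax ay bx by cx cy qx qy
    cramerᵧ : cross a (bx , by) (cx , cy) * (qy - ay)
            ≡ cross a (bx , by) (qx , qy) * (cy - ay) - cross a (cx , cy) (qx , qy) * (by - ay)
    cramerᵧ = solve 8 (λ ax ay bx by cx cy qx qy →
      ((bx :- ax) :* (cy :- ay) :- (by :- ay) :* (cx :- ax)) :* (qy :- ay) :=
      ((bx :- ax) :* (qy :- ay) :- (by :- ay) :* (qx :- ax)) :* (cy :- ay) :-
      ((cx :- ax) :* (qy :- ay) :- (cy :- ay) :* (qx :- ax)) :* (by :- ay)) refl ax ay bx by cx cy qx qy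

  pencilPoint : Point → ℕ → Point
  pencilPoint (zx , zy) t = (zx + 1# , zy + t ×′ 1#)

  ≢-pencilPoint : ∀ z t → ¬ z ≡ pencilPoint z t
  ≢-pencilPoint (zx , zy) t z≡ = 0≢1 (+-cancelˡ zx 0# 1# (trans (+-identityʳ zx) (cong proj₁ z≡)))

  pencil : Point → ℕ → Line
  pencil z t = lineThrough z (pencilPoint z t) (≢-pencilPoint z t)

  ∈-pencil : ∀ z t → z ∈L pencil z t
  ∈-pencil z t = Equivalence.from (∈-lineThrough⇔ z _ (≢-pencilPoint z t) z) (cross-left z _)

  cross-pencilPoints : ∀ z s t → cross z (pencilPoint z s) (pencilPoint z t) ≡ t ×′ 1# - s ×′ 1#
  cross-pencilPoints (zx , zy) s t = begin
    cross (zx , zy) (zx + 1# , zy + s ×′ 1#) (zx + 1# , zy + t ×′ 1#)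
      ≡⟨ solve 5 (λ zx zy o s t →
           (zx :+ o :- zx) :* (zy :+ t :- zy) :- (zy :+ s :- zy) :* (zx :+ o :- zx) := o :* t :- s :* o)
           refl zx zy 1# (s ×′ 1#) (t ×′ 1#) ⟩
    1# * t ×′ 1# - s ×′ 1# * 1#
      ≡⟨ cong₂ _-_ (*-identityˡ _) (*-identityʳ _) ⟩
    t ×′ 1# - s ×′ 1# ∎

  pencil-unique : ∀ z w {s t} → ¬ w ≡ z → w ∈L pencil z s → w ∈L pencil z t → s ≡ t
  pencil-unique z w {s} {t} w≢z w∈s w∈t with cross z (pencilPoint z s) (pencilPoint z t) ≟ 0#
  ... | no  ≢0 = ⊥-elim (w≢z (≡-at-intersection _ _ _ w ≢0 (on-pencil s w∈s) (on-pencil t w∈t)))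
    where
    on-pencil : ∀ u → w ∈L pencil z u → cross z (pencilPoint z u) w ≡ 0#
    on-pencil u = Equivalence.to (∈-lineThrough⇔ z _ (≢-pencilPoint z u) w)
  ... | yes ≡0 = sym (×′1-injective t s (x∙y⁻¹≈ε⇒x≈y _ _ (trans (sym (cross-pencilPoints z s t)) ≡0)))

  pencil-avoiding : ∀ z ws → ∃ λ t → All (λ w → ¬ w ≡ z → ¬ w ∈L pencil z t) ws
  pencil-avoiding z ws = map₂ (All.map curry) (unblocked-index Blocks Blocks? Blocks-unique ws)
    where
    Blocks : Point → ℕ → Set
    Blocks w t = ¬ w ≡ z × w ∈L pencil z t
    Blocks? : ∀ w t → Dec (Blocks w t)
    Blocks? w t = ¬? (w ≟ₚ z) ×-dec (w ∈L? pencil z t)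
    Blocks-unique : ∀ w {s t} → Blocks w s → Blocks w t → s ≡ t
    Blocks-unique w (w≢z , w∈s) (_ , w∈t) = pencil-unique z w w≢z w∈s w∈t

  vertical : ℕ → Line
  vertical t = line 1# 0# (t ×′ 1#) λ (1≡0 , _) → 0≢1 (sym 1≡0)

  vertical-avoiding : ∀ ws → ∃ λ t → All (λ w → ¬ w ∈L vertical t) ws
  vertical-avoiding = unblocked-index (λ w t → w ∈L vertical t) (λ w t → w ∈L? vertical t)
    (λ w w∈s w∈t → ×′1-injective _ _ (trans (sym w∈s) w∈t))

  NoThreeCollinear : ∀ {n} → (Fin n → Point) → Set
  NoThreeCollinear p = ∀ i j k → ¬ i ≡ j → ¬ j ≡ k → ¬ i ≡ k → ¬ cross (p i) (p j) (p k) ≡ 0#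

  module Shattering {n} (p : Fin n → Point) (p-injective : ∀ i j → p i ≡ p j → i ≡ j)
    (noncollinear : NoThreeCollinear p) (q₁ q₂ : Point)
    (q₁∉P : ∀ i → ¬ q₁ ≡ p i) (q₂∉P : ∀ i → ¬ q₂ ≡ p i) (Z : Fin n → Bool) where

    Good : Line → Set
    Good L = ¬ q₁ ∈L L × ¬ q₂ ∈L L × (∀ k → p k ∈L L → Z k ≡ true)

    Cut : Set
    Cut = ∃ λ L → InF2' q₁ q₂ L × (∀ i → (p i ∈∪ L) ⇔ (Z i ≡ true))

    cut : ∀ {zs} L₁ L₂ → Good L₁ → Good L₂ → (∀ i → Z i ≡ true → i ∈ zs) →
          All (λ i → p i ∈∪ (L₁ , L₂)) zs → Cut
    cut L₁ L₂ (q₁∉L₁ , q₂∉L₁ , Z-on-L₁) (q₁∉L₂ , q₂∉L₂ , Z-on-L₂) listed on-lines =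
      (L₁ , L₂) , ([ q₁∉L₁ , q₁∉L₂ ] , [ q₂∉L₁ , q₂∉L₂ ]) ,
      λ i → mk⇔ [ Z-on-L₁ i , Z-on-L₂ i ] (λ Zi → All.lookup on-lines (listed i Zi))

    forbidden : List Point
    forbidden = q₁ ∷ q₂ ∷ tabulate p

    good-line-missing-P : Σ Line Good
    good-line-missing-P with vertical-avoiding forbidden
    ... | t , q₁∉L ∷ q₂∉L ∷ P∉L = vertical t , q₁∉L , q₂∉L , λ k pk∈L → ⊥-elim (tabulate⁻ P∉L k pk∈L)

    good-line-through : ∀ i → Z i ≡ true → ∃ λ L → Good L × p i ∈L L
    good-line-through i Zi with pencil-avoiding (p i) forbidden
    ... | t , q₁∉L ∷ q₂∉L ∷ P∉L =
      pencil (p i) t , (q₁∉L (q₁∉P i) , q₂∉L (q₂∉P i) , only-p-i) , ∈-pencil (p i) t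
      where
      only-p-i : ∀ k → p k ∈L pencil (p i) t → Z k ≡ true
      only-p-i k pk∈L with k Fin.≟ i
      ... | yes refl = Zi
      ... | no  k≢i  = ⊥-elim (tabulate⁻ P∉L k (k≢i ∘ p-injective k i) pk∈L)

    Outside : Set
    Outside = ∃ λ q → ∀ i → ¬ q ≡ p i

    Side : Fin n → Fin n → Outside → Set
    Side i j (q , _) = cross (p i) (p j) q ≡ 0#

    Side? : ∀ i j q → Dec (Side i j q)
    Side? i j (q , _) = cross (p i) (p j) q ≟ 0#

    Side-sym : ∀ {i j} q → Side i j q → Side j i q
    Side-sym _ = cross≡0-swap

    FreeSide : Fin n → Fin n → Set
    FreeSide i j = ¬ Side i j (q₁ , q₁∉P) × ¬ Side i j (q₂ , q₂∉P)

    good-side : ∀ i j → ¬ i ≡ j → Z i ≡ true → Z j ≡ true → FreeSide i j →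
                ∃ λ L → Good L × p i ∈L L × p j ∈L L
    good-side i j i≢j Zi Zj (q₁∉ij , q₂∉ij) =
      L , (q₁∉ij ∘ to , q₂∉ij ∘ to , only-p-i-p-j) , from (cross-left (p i) (p j)) , from (cross-right (p i) (p j))
      where
      pi≢pj : ¬ p i ≡ p j
      pi≢pj = i≢j ∘ p-injective i j
      L : Line
      L = lineThrough (p i) (p j) pi≢pj
      to : ∀ {r} → r ∈L L → cross (p i) (p j) r ≡ 0#
      to = Equivalence.to (∈-lineThrough⇔ _ _ pi≢pj _)
      from : ∀ {r} → cross (p i) (p j) r ≡ 0# → r ∈L L
      from = Equivalence.from (∈-lineThrough⇔ _ _ pi≢pj _)
      only-p-i-p-j : ∀ k → p k ∈L L → Z k ≡ true
      only-p-i-p-j k pk∈L with k Fin.≟ i | k Fin.≟ j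
      ... | yes refl | _        = Zi
      ... | no  _    | yes refl = Zj
      ... | no  k≢i  | no  k≢j  = ⊥-elim (noncollinear i j k i≢j (≢-sym k≢j) (≢-sym k≢i) (to pk∈L))

    not-on-adjacent-sides : ∀ {v a b} → ¬ v ≡ a → ¬ v ≡ b → ¬ a ≡ b → ∀ q → Side v a q → Side v b q → ⊥
    not-on-adjacent-sides {v} {a} {b} v≢a v≢b a≢b (q , q∉P) on-va on-vb =
      q∉P v (≡-at-intersection _ _ _ q (noncollinear v a b v≢a a≢b v≢b) on-va on-vb)

    free-side : ∀ i j k → ¬ i ≡ j → ¬ i ≡ k → ¬ j ≡ k → FreeSide i j ⊎ FreeSide i k ⊎ FreeSide j k
    free-side i j k i≢j i≢k j≢k =
      one-of-three-avoids-both (Side i j) (Side i k) (Side j k) (Side? i j) (Side? i k)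
        (not-on-adjacent-sides i≢j i≢k j≢k)
        (λ q on-ij → not-on-adjacent-sides (≢-sym i≢j) j≢k i≢k q (Side-sym q on-ij))
        (λ q on-ik → not-on-adjacent-sides (≢-sym i≢k) (≢-sym j≢k) i≢j q (Side-sym q on-ik) ∘ Side-sym q)
        (q₁ , q₁∉P) (q₂ , q₂∉P)

    Matching : Fin n → Fin n → Fin n → Fin n → Outside → Set
    Matching i j k l q = Side i j q ⊎ Side k l q

    Matching? : ∀ i j k l q → Dec (Matching i j k l q)
    Matching? i j k l q = Side? i j q ⊎-dec Side? k l q

    Matching-swap : ∀ {i j k l} q → Matching i j k l q → Matching i j l k q
    Matching-swap q = Sum.map₂ (Side-sym q)

    matchings-exclusive : ∀ {i j k l} → ¬ i ≡ j → ¬ i ≡ k → ¬ i ≡ l → ¬ j ≡ k → ¬ j ≡ l → ¬ k ≡ l →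
                          ∀ q → Matching i j k l q → Matching i k j l q → ⊥
    matchings-exclusive i≢j i≢k i≢l j≢k j≢l k≢l q (inj₁ on-ij) (inj₁ on-ik) =
      not-on-adjacent-sides i≢j i≢k j≢k q on-ij on-ik
    matchings-exclusive i≢j i≢k i≢l j≢k j≢l k≢l q (inj₁ on-ij) (inj₂ on-jl) =
      not-on-adjacent-sides (≢-sym i≢j) j≢l i≢l q (Side-sym q on-ij) on-jl
    matchings-exclusive i≢j i≢k i≢l j≢k j≢l k≢l q (inj₂ on-kl) (inj₁ on-ik) =
      not-on-adjacent-sides k≢l (≢-sym i≢k) (≢-sym i≢l) q on-kl (Side-sym q on-ik)
    matchings-exclusive i≢j i≢k i≢l j≢k j≢l k≢l q (inj₂ on-kl) (inj₂ on-jl) =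
      not-on-adjacent-sides (≢-sym k≢l) (≢-sym j≢l) (≢-sym j≢k) q (Side-sym q on-kl) (Side-sym q on-jl)

    FreeMatching : Fin n → Fin n → Fin n → Fin n → Set
    FreeMatching i j k l = FreeSide i j × FreeSide k l

    free-matching : ∀ i j k l → ¬ i ≡ j → ¬ i ≡ k → ¬ i ≡ l → ¬ j ≡ k → ¬ j ≡ l → ¬ k ≡ l →
                    FreeMatching i j k l ⊎ FreeMatching i k j l ⊎ FreeMatching i l j k
    free-matching i j k l i≢j i≢k i≢l j≢k j≢l k≢l =
      Sum.map free (Sum.map free free)
        (one-of-three-avoids-both (Matching i j k l) (Matching i k j l) (Matching i l j k)
          (Matching? i j k l) (Matching? i k j l)
          (matchings-exclusive i≢j i≢k i≢l j≢k j≢l k≢l)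
          (λ q m₁ m₃ → matchings-exclusive i≢j i≢l i≢k j≢l j≢k (≢-sym k≢l) q (Matching-swap q m₁) m₃)
          (λ q m₂ m₃ → matchings-exclusive i≢k i≢l i≢j k≢l (≢-sym j≢k) (≢-sym j≢l) q
                         (Matching-swap q m₂) (Matching-swap q m₃))
          (q₁ , q₁∉P) (q₂ , q₂∉P))
      where
      free : ∀ {a b c d} → ¬ Matching a b c d (q₁ , q₁∉P) × ¬ Matching a b c d (q₂ , q₂∉P) → FreeMatching a b c d
      free (¬m₁ , ¬m₂) = (¬m₁ ∘ inj₁ , ¬m₂ ∘ inj₁) , (¬m₁ ∘ inj₂ , ¬m₂ ∘ inj₂)

    cut-listed : (zs : List (Fin n)) → (∀ i → Z i ≡ true → i ∈ zs) → AllPairs (λ i j → ¬ i ≡ j) zs →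
                 All (λ i → Z i ≡ true) zs → length zs ≤ 4 → Cut
    cut-listed [] listed _ _ _ =
      let L , good = good-line-missing-P in cut L L good good listed ([])
    cut-listed (i ∷ []) listed _ (Zi ∷ []) _ =
      let L , good , on-i = good-line-through i Zi in cut L L good good listed ((inj₁ on-i ∷ []))
    cut-listed (i ∷ j ∷ []) listed _ (Zi ∷ Zj ∷ []) _ =
      let L₁ , good₁ , on-i = good-line-through i Zi
          L₂ , good₂ , on-j = good-line-through j Zj
      in cut L₁ L₂ good₁ good₂ listed ((inj₁ on-i ∷ inj₂ on-j ∷ []))
    cut-listed (i ∷ j ∷ k ∷ []) listed ((i≢j ∷ i≢k ∷ []) ∷ (j≢k ∷ []) ∷ [] ∷ []) (Zi ∷ Zj ∷ Zk ∷ []) _ =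
      by-side (free-side i j k i≢j i≢k j≢k)
      where
      by-side : FreeSide i j ⊎ FreeSide i k ⊎ FreeSide j k → Cut
      by-side (inj₁ free-ij) =
        let L₁ , good₁ , on-i , on-j = good-side i j i≢j Zi Zj free-ij
            L₂ , good₂ , on-k = good-line-through k Zk
        in cut L₁ L₂ good₁ good₂ listed ((inj₁ on-i ∷ inj₁ on-j ∷ inj₂ on-k ∷ []))
      by-side (inj₂ (inj₁ free-ik)) =
        let L₁ , good₁ , on-i , on-k = good-side i k i≢k Zi Zk free-ik
            L₂ , good₂ , on-j = good-line-through j Zj
        in cut L₁ L₂ good₁ good₂ listed ((inj₁ on-i ∷ inj₂ on-j ∷ inj₁ on-k ∷ []))
      by-side (inj₂ (inj₂ free-jk)) =
        let L₁ , good₁ , on-j , on-k = good-side j k j≢k Zj Zk free-jk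
            L₂ , good₂ , on-i = good-line-through i Zi
        in cut L₁ L₂ good₁ good₂ listed ((inj₂ on-i ∷ inj₁ on-j ∷ inj₁ on-k ∷ []))
    cut-listed (i ∷ j ∷ k ∷ l ∷ []) listed
      ((i≢j ∷ i≢k ∷ i≢l ∷ []) ∷ (j≢k ∷ j≢l ∷ []) ∷ (k≢l ∷ []) ∷ [] ∷ []) (Zi ∷ Zj ∷ Zk ∷ Zl ∷ []) _ =
      by-matching (free-matching i j k l i≢j i≢k i≢l j≢k j≢l k≢l)
      where
      by-matching : FreeMatching i j k l ⊎ FreeMatching i k j l ⊎ FreeMatching i l j k → Cut
      by-matching (inj₁ (free-ij , free-kl)) =
        let L₁ , good₁ , on-i , on-j = good-side i j i≢j Zi Zj free-ij
            L₂ , good₂ , on-k , on-l = good-side k l k≢l Zk Zl free-kl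
        in cut L₁ L₂ good₁ good₂ listed ((inj₁ on-i ∷ inj₁ on-j ∷ inj₂ on-k ∷ inj₂ on-l ∷ []))
      by-matching (inj₂ (inj₁ (free-ik , free-jl))) =
        let L₁ , good₁ , on-i , on-k = good-side i k i≢k Zi Zk free-ik
            L₂ , good₂ , on-j , on-l = good-side j l j≢l Zj Zl free-jl
        in cut L₁ L₂ good₁ good₂ listed ((inj₁ on-i ∷ inj₂ on-j ∷ inj₁ on-k ∷ inj₂ on-l ∷ []))
      by-matching (inj₂ (inj₂ (free-il , free-jk))) =
        let L₁ , good₁ , on-i , on-l = good-side i l i≢l Zi Zl free-il
            L₂ , good₂ , on-j , on-k = good-side j k j≢k Zj Zk free-jk
        in cut L₁ L₂ good₁ good₂ listed ((inj₁ on-i ∷ inj₂ on-j ∷ inj₂ on-k ∷ inj₁ on-l ∷ []))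
    cut-listed (_ ∷ _ ∷ _ ∷ _ ∷ _ ∷ _) _ _ _ (s≤s (s≤s (s≤s (s≤s ()))))

    cut-out : n ≤ 4 → Cut
    cut-out n≤4 = cut-listed (filter Z? (allFin n)) listed (filter⁺ Z? (allFin⁺ n)) (all-filter Z? (allFin n))
      (ℕ.≤-trans (length-filter Z? (allFin n)) (subst (_≤ 4) (sym (length-tabulate {n = n} (λ i → i))) n≤4))
      where
      Z? : ∀ i → Dec (Z i ≡ true)
      Z? i = Z i Bool.≟ true
      listed : ∀ i → Z i ≡ true → i ∈ filter Z? (allFin n)
      listed i Zi = ∈-filter⁺ Z? (∈-allFin i) Zi

lemma5p1 : (ℝ : RealField) → let open Plane ℝ in
    (n : ℕ) → n ≤ 4 → (p : Fin n → Point) →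
    (∀ i j → p i ≡ p j → i ≡ j) →
    (∀ i j k → ¬ (i ≡ j) → ¬ (j ≡ k) → ¬ (i ≡ k) → ¬ Collinear (p i) (p j) (p k)) →
    (q₁ q₂ : Point) → (∀ i → ¬ (q₁ ≡ p i)) → (∀ i → ¬ (q₂ ≡ p i)) →
    Shatters (InF2' q₁ q₂) p
lemma5p1 ℝ n n≤4 p p-injective no-three-collinear q₁ q₂ q₁∉P q₂∉P Z =
  Shattering.cut-out p p-injective noncollinear q₁ q₂ q₁∉P q₂∉P Z n≤4
  where
  open Geometry ℝ
  noncollinear : NoThreeCollinear p
  noncollinear i j k i≢j j≢k i≢k =
    no-three-collinear i j k i≢j j≢k i≢k ∘ cross≡0⇒collinear _ _ _ (i≢j ∘ p-injective i j)
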